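{- Let $n\ge 1$ be an integer. If $\Gamma$ is a finite simple graph with $A(\Gamma;x)=n\,x^n$, then $\Gamma$ is isomorphic to the empty graph $E_n$ (the graph with $n$ vertices and no edges).
   Context: All graphs are finite and simple with at least one vertex. For a graph $\Gamma=(V,E)$ of order $N$, a vertex $v$ and $X\subseteq V$, $\delta_X(v)$ is the number of neighbours of $v$ in $X$, $\delta_1$ the maximum degree, $\bar S=V\setminus S$, and $\mathcal{K}=[-\delta_1,\delta_1]\cap\mathbb{Z}$. A nonempty $S\subseteq V$ is a defensive $k$-alliance if $\delta_S(v)\ge\delta_{\bar S}(v)+k$ for all $v\in S$; its exact index of alliance is $k_S=\max\{k\in\mathcal{K}: S \text{ is a defensive } k\text{ -alliance}\}$. The alliance polynomial is $A(\Gamma;x)=\sum_{S} x^{N+k_S}$, the sum over all nonempty $S\subseteq V$ with induced subgraph $\langle S\rangle$ connected. -}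

module Defs where

open import Data.Bool using (Bool; true; false; _∧_; _∨_; not; if_then_else_)
open import Data.Nat as ℕ using (ℕ; zero; suc)
open import Data.Integer as ℤ using (ℤ; +_)
open import Data.Fin using (Fin)
open import Data.Vec using (Vec; []; _∷_; lookup)
open import Data.List as List using (List; []; _∷_; _++_; map; length; allFin; upTo; foldr)
open import Data.Bool.ListAction using (and; or)
open import Data.Fin.Subset using (Subset)
open import Relation.Nullary.Decidable using (does)
open import Relation.Binary.PropositionalEquality using (_≡_)
open import Function.Bundles using (_↔_; Inverse)

record Graph : Set where
  field
    N      : ℕ
    N≥1    : 1 ℕ.≤ N
    adj    : Fin N → Fin N → Bool
    sym    : ∀ u v → adj u v ≡ adj v u
    irrefl : ∀ v → adj v v ≡ false

open Graph public

filterB : {A : Set} → (A → Bool) → List A → List A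
filterB p []       = []
filterB p (x ∷ xs) = if p x then x ∷ filterB p xs else filterB p xs

E : (n : ℕ) → 1 ℕ.≤ n → Graph
E n p = record { N = n ; N≥1 = p ; adj = λ _ _ → false
               ; sym = λ _ _ → Relation.Binary.PropositionalEquality.refl
               ; irrefl = λ _ → Relation.Binary.PropositionalEquality.refl }

record _≅_ (Γ Δ : Graph) : Set where
  field
    bij      : Fin (N Γ) ↔ Fin (N Δ)
    preserve : ∀ u v → adj Δ (Inverse.to bij u) (Inverse.to bij v) ≡ adj Γ u v

module _ (Γ : Graph) where

  private
    V = allFin (N Γ)

  δ : Subset (N Γ) → Fin (N Γ) → ℕ
  δ X v = length (filterB (λ u → lookup X u ∧ adj Γ v u) V)

  deg : Fin (N Γ) → ℕ
  deg v = length (filterB (λ u → adj Γ v u) V)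

  δ₁ : ℕ
  δ₁ = foldr ℕ._⊔_ 0 (map deg V)

  compl : Subset (N Γ) → Subset (N Γ)
  compl = Data.Vec.map not

  -- S is a defensive k-alliance:  δ_S(v) ≥ δ_{S̄}(v) + k  for all v ∈ S
  -- (nonemptiness of S is imposed separately in the polynomial).
  isAllianceB : Subset (N Γ) → ℤ → Bool
  isAllianceB S k =
    and (map (λ v → if lookup S v
                      then does ((+ δ (compl S) v) ℤ.+ k ℤ.≤? + δ S v)
                      else true) V)

  𝒦 : List ℤ
  𝒦 = map (λ i → + i ℤ.- + δ₁) (upTo (suc (2 ℕ.* δ₁)))

  -- exact index of alliance k_S = max { k ∈ 𝒦 : S is a defensive k-alliance }
  -- (the base value -δ₁ is the least element of 𝒦, so it never exceeds the max;
  --  the set is nonempty for every nonempty S since k = -δ₁ always works)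
  kS : Subset (N Γ) → ℤ
  kS S = foldr ℤ._⊔_ (ℤ.- (+ δ₁)) (filterB (isAllianceB S) 𝒦)

  walkB : Subset (N Γ) → ℕ → Fin (N Γ) → Fin (N Γ) → Bool
  walkB S zero    u v = lookup S u ∧ lookup S v ∧ does (Data.Fin._≟_ u v)
  walkB S (suc m) u v =
    walkB S m u v ∨ or (map (λ w → lookup S u ∧ adj Γ u w ∧ walkB S m w v) V)

  -- ⟨S⟩ connected: every two vertices of S are joined by a walk in ⟨S⟩
  -- (walks of length ≤ N suffice, as any path has < N edges)
  connectedB : Subset (N Γ) → Bool
  connectedB S = and (map (λ u → and (map (λ v →
                   if lookup S u ∧ lookup S v then walkB S (N Γ) u v else true) V)) V)

  nonemptyB : Subset (N Γ) → Bool
  nonemptyB S = or (map (lookup S) V)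

subsets : (n : ℕ) → List (Subset n)
subsets zero    = [] ∷ []
subsets (suc n) = map (true ∷_) (subsets n) ++ map (false ∷_) (subsets n)

-- Coefficient of x^j in the alliance polynomial
--   A(Γ;x) = Σ_{S ≠ ∅, ⟨S⟩ connected} x^{N + k_S}
allianceCoeff : (Γ : Graph) → ℤ → ℕ
allianceCoeff Γ j = length (filterB
  (λ S → nonemptyB Γ S ∧ connectedB Γ S ∧ does ((+ N Γ) ℤ.+ kS Γ S ℤ.≟ j))
  (subsets (N Γ)))

monoCoeff : ℕ → ℤ → ℕ
monoCoeff n j = if does (j ℤ.≟ + n) then n else 0

module Submission where

-- Every singleton {v} is nonempty and induces a connected subgraph, so it
-- contributes the monomial x^(N + k_{v}) to A(Γ;x).  As n·xⁿ has the single
-- exponent n, N + k_{v} = n for every vertex v; and the N singletons are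
-- distinct subsets all counted in the coefficient n of xⁿ, so N ≤ n.  On the
-- other hand {v} is a defensive k-alliance only if deg v + k ≤ 0 (its one
-- vertex has no neighbour inside and deg v neighbours outside), hence
-- k_{v} ≤ -deg v.  Together these force deg v = 0 and N = n, i.e. Γ is the
-- edgeless graph on n vertices.

open import Defs
open import Data.Nat using (ℕ; _≤_)
open import Data.Integer using (ℤ)
open import Relation.Binary.PropositionalEquality using (_≡_)

open import Data.Bool using (Bool; true; false; T; not; _∧_; if_then_else_)
open import Data.Bool.Properties using (T-∧; T-∨; T-≡)
open import Data.Empty using (⊥-elim)
open import Data.Fin using (Fin; zero; suc; fromℕ<; _≟_)
open import Data.Fin.Subset using (Subset; ⁅_⁆; ⊥)
open import Data.Fin.Subset.Properties using (x∈⁅x⁆; x∈⁅y⁆⇒x≡y)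
open import Data.Integer as ℤ using (+_; -[1+_]; +≤+)
import Data.Integer.Properties as ℤP
open import Data.List using (List; []; _∷_; _++_; map; length; allFin; foldr)
open import Data.List.Membership.Propositional using (_∈_; lose)
open import Data.List.Membership.Propositional.Properties
  using (∈-allFin; ∈-++⁺ˡ; ∈-++⁺ʳ; ∈-map⁺)
open import Data.List.Relation.Unary.All as All using ()
open import Data.List.Relation.Unary.All.Properties using (all⁺; all⁻)
open import Data.List.Relation.Unary.Any using (here; there)
open import Data.List.Relation.Unary.Any.Properties using (any⁺)
open import Data.Nat as ℕ using (zero; suc; z≤n; s≤s)
import Data.Nat.Properties as ℕP
open import Data.Product using (_×_; _,_; proj₁; proj₂; uncurry)
open import Data.Sum using (inj₁)
open import Data.Unit using (tt)
open import Data.Vec using ([]; _∷_; lookup)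
open import Data.Vec.Properties using (lookup⇒[]=; []=⇒lookup; lookup-map)
open import Function using (_∘_)
open import Function.Bundles using (Equivalence)
open import Function.Construct.Identity using (↔-id)
open import Relation.Nullary using (¬_; Dec; yes; no)
open import Relation.Nullary.Decidable using (does)
open import Relation.Binary.PropositionalEquality
  using (refl; trans; cong; cong₂; subst; subst₂; module ≡-Reasoning)
  renaming (sym to ≡-sym)

module _ {A : Set} where

  length-filterB-++ : (p : A → Bool) (xs ys : List A) →
    length (filterB p (xs ++ ys)) ≡ length (filterB p xs) ℕ.+ length (filterB p ys)
  length-filterB-++ p []       ys = refl
  length-filterB-++ p (x ∷ xs) ys with p x
  ... | true  = cong suc (length-filterB-++ p xs ys)
  ... | false = length-filterB-++ p xs ys

  length-filterB-map : {B : Set} (p : B → Bool) (f : A → B) (xs : List A) →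
    length (filterB p (map f xs)) ≡ length (filterB (p ∘ f) xs)
  length-filterB-map p f []       = refl
  length-filterB-map p f (x ∷ xs) with p (f x)
  ... | true  = cong suc (length-filterB-map p f xs)
  ... | false = length-filterB-map p f xs

  filterB-nonempty : (p : A → Bool) {x : A} {xs : List A} → x ∈ xs → T (p x) →
    1 ≤ length (filterB p xs)
  filterB-nonempty p {xs = y ∷ xs} (here refl) px with p y
  ... | true  = s≤s z≤n
  ... | false = ⊥-elim px
  filterB-nonempty p {xs = y ∷ xs} (there x∈xs) px with p y
  ... | true  = s≤s z≤n
  ... | false = filterB-nonempty p x∈xs px

  filterB-cong : (p q : A → Bool) → (∀ x → p x ≡ q x) → (xs : List A) →
    filterB p xs ≡ filterB q xs
  filterB-cong p q p≗q []       = refl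
  filterB-cong p q p≗q (x ∷ xs) rewrite p≗q x with q x
  ... | true  = cong (x ∷_) (filterB-cong p q p≗q xs)
  ... | false = filterB-cong p q p≗q xs

  filterB-none : (p : A → Bool) → (∀ x → ¬ T (p x)) → (xs : List A) →
    filterB p xs ≡ []
  filterB-none p ¬p []       = refl
  filterB-none p ¬p (x ∷ xs) with p x | ¬p x
  ... | true  | ¬px = ⊥-elim (¬px tt)
  ... | false | _   = filterB-none p ¬p xs

  ≤-maximum : (f : A → ℕ) {x : A} {xs : List A} → x ∈ xs →
    f x ≤ foldr ℕ._⊔_ 0 (map f xs)
  ≤-maximum f {xs = y ∷ xs} (here refl)  = ℕP.m≤m⊔n (f y) _
  ≤-maximum f {xs = y ∷ xs} (there x∈xs) =
    ℕP.≤-trans (≤-maximum f x∈xs) (ℕP.m≤n⊔m (f y) _)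

maximum-filterB-≤ : (p : ℤ → Bool) {b c : ℤ} → b ℤ.≤ c →
  (∀ x → T (p x) → x ℤ.≤ c) → (xs : List ℤ) → foldr ℤ._⊔_ b (filterB p xs) ℤ.≤ c
maximum-filterB-≤ p b≤c bound []       = b≤c
maximum-filterB-≤ p b≤c bound (x ∷ xs) with p x | bound x
... | true  | x≤c = ℤP.⊔-lub (x≤c tt) (maximum-filterB-≤ p b≤c bound xs)
... | false | _   = maximum-filterB-≤ p b≤c bound xs

implicationᵇ-intro : {b x : Bool} → (T b → T x) → T (if b then x else true)
implicationᵇ-intro {false} _    = tt
implicationᵇ-intro {true}  b⇒x = b⇒x tt

implicationᵇ-elim : {b x : Bool} → T (if b then x else true) → T b → T x
implicationᵇ-elim {true} x _ = x

does-sound : {P : Set} (a? : Dec P) → T (does a?) → P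
does-sound (yes p) _ = p

does-complete : {P : Set} (a? : Dec P) → P → T (does a?)
does-complete (yes _) _ = tt
does-complete (no ¬p) p = ¬p p

subsets-complete : (n : ℕ) (S : Subset n) → S ∈ subsets n
subsets-complete zero    []          = here refl
subsets-complete (suc n) (true ∷ S)  = ∈-++⁺ˡ (∈-map⁺ (true ∷_) (subsets-complete n S))
subsets-complete (suc n) (false ∷ S) =
  ∈-++⁺ʳ (map (true ∷_) (subsets n)) (∈-map⁺ (false ∷_) (subsets-complete n S))

-- By induction, ⁅ zero ⁆ lies in the
-- half of `subsets (suc n)` containing zero and the other singletons in the
-- half avoiding it.
singletons-counted : (n : ℕ) (P : Subset n → Bool) → (∀ i → T (P ⁅ i ⁆)) →
  n ≤ length (filterB P (subsets n))
singletons-counted zero    P P⁅i⁆ = z≤n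
singletons-counted (suc n) P P⁅i⁆ = begin
  1 ℕ.+ n
    ≤⟨ ℕP.+-mono-≤ (filterB-nonempty (P ∘ (true ∷_)) (subsets-complete n ⊥) (P⁅i⁆ zero))
                   (singletons-counted n (P ∘ (false ∷_)) (P⁅i⁆ ∘ suc)) ⟩
  length (filterB (P ∘ (true ∷_)) (subsets n)) ℕ.+ length (filterB (P ∘ (false ∷_)) (subsets n))
    ≡⟨ ≡-sym (cong₂ ℕ._+_ (length-filterB-map P (true ∷_) (subsets n))
                        (length-filterB-map P (false ∷_) (subsets n))) ⟩
  length (filterB P (map (true ∷_) (subsets n))) ℕ.+ length (filterB P (map (false ∷_) (subsets n)))
    ≡⟨ ≡-sym (length-filterB-++ P (map (true ∷_) (subsets n)) (map (false ∷_) (subsets n))) ⟩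
  length (filterB P (subsets (suc n))) ∎
  where open ℕP.≤-Reasoning

⁅⁆-self : {n : ℕ} (v : Fin n) → T (lookup ⁅ v ⁆ v)
⁅⁆-self v = Equivalence.from T-≡ ([]=⇒lookup (x∈⁅x⁆ v))

⁅⁆-only : {n : ℕ} (v u : Fin n) → T (lookup ⁅ v ⁆ u) → u ≡ v
⁅⁆-only v u u∈⁅v⁆ = x∈⁅y⁆⇒x≡y v (lookup⇒[]= u ⁅ v ⁆ (Equivalence.to T-≡ u∈⁅v⁆))

module Singletons (Γ : Graph) where

  private
    V : List (Fin (N Γ))
    V = allFin (N Γ)

  walk-refl : (S : Subset (N Γ)) {v : Fin (N Γ)} → T (lookup S v) → (m : ℕ) →
    T (walkB Γ S m v v)
  walk-refl S {v} v∈S zero =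
    Equivalence.from T-∧ (v∈S , Equivalence.from T-∧ (v∈S , does-complete (v ≟ v) refl))
  walk-refl S v∈S (suc m) = Equivalence.from T-∨ (inj₁ (walk-refl S v∈S m))

  singleton-nonempty : (v : Fin (N Γ)) → T (nonemptyB Γ ⁅ v ⁆)
  singleton-nonempty v = any⁺ (lookup ⁅ v ⁆) (lose (∈-allFin v) (⁅⁆-self v))

  singleton-connected : (v : Fin (N Γ)) → T (connectedB Γ ⁅ v ⁆)
  singleton-connected v =
    all⁻ _ (All.universal (λ u → all⁻ _ (All.universal (λ w →
      implicationᵇ-intro (λ u,w∈⁅v⁆ → joined u w (Equivalence.to T-∧ u,w∈⁅v⁆))) V)) V)
    where
    joined : (u w : Fin (N Γ)) → T (lookup ⁅ v ⁆ u) × T (lookup ⁅ v ⁆ w) →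
      T (walkB Γ ⁅ v ⁆ (N Γ) u w)
    joined u w (u∈ , w∈) rewrite ⁅⁆-only v u u∈ | ⁅⁆-only v w w∈ =
      walk-refl ⁅ v ⁆ (⁅⁆-self v) (N Γ)

  no-neighbour-in-⁅⁆ : (v u : Fin (N Γ)) → T (lookup ⁅ v ⁆ u) → ¬ T (adj Γ v u)
  no-neighbour-in-⁅⁆ v u u∈⁅v⁆ rewrite ⁅⁆-only v u u∈⁅v⁆ = subst T (irrefl Γ v)

  δ-⁅⁆ : (v : Fin (N Γ)) → δ Γ ⁅ v ⁆ v ≡ 0
  δ-⁅⁆ v = cong length (filterB-none _
    (λ u → uncurry (no-neighbour-in-⁅⁆ v u) ∘ Equivalence.to T-∧) V)

  δ-compl-⁅⁆ : (v : Fin (N Γ)) → δ Γ (compl Γ ⁅ v ⁆) v ≡ deg Γ v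
  δ-compl-⁅⁆ v = cong length (filterB-cong _ _ outside V)
    where
    absorb : {b a : Bool} → (T b → ¬ T a) → not b ∧ a ≡ a
    absorb {false}         _ = refl
    absorb {true} {false}  _ = refl
    absorb {true} {true} b⇒¬a = ⊥-elim (b⇒¬a tt tt)
    outside : ∀ u → lookup (compl Γ ⁅ v ⁆) u ∧ adj Γ v u ≡ adj Γ v u
    outside u = trans (cong (_∧ adj Γ v u) (lookup-map u not ⁅ v ⁆))
                      (absorb (no-neighbour-in-⁅⁆ v u))

  singleton-alliance-bound : (v : Fin (N Γ)) (k : ℤ) → T (isAllianceB Γ ⁅ v ⁆ k) →
    k ℤ.≤ ℤ.- (+ deg Γ v)
  singleton-alliance-bound v k alliance = ℤP.i-j≤0⇒i≤j (subst (ℤ._≤ + 0) reorder condition)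
    where
    condition-at-v : T (if lookup ⁅ v ⁆ v
      then does (+ δ Γ (compl Γ ⁅ v ⁆) v ℤ.+ k ℤ.≤? + δ Γ ⁅ v ⁆ v) else true)
    condition-at-v = All.lookup (all⁺ _ V alliance) (∈-allFin v)
    condition : + deg Γ v ℤ.+ k ℤ.≤ + 0
    condition = subst₂ (λ out inn → + out ℤ.+ k ℤ.≤ + inn) (δ-compl-⁅⁆ v) (δ-⁅⁆ v)
      (does-sound (_ ℤ.≤? _) (implicationᵇ-elim condition-at-v (⁅⁆-self v)))
    reorder : + deg Γ v ℤ.+ k ≡ k ℤ.- ℤ.- (+ deg Γ v)
    reorder = trans (ℤP.+-comm (+ deg Γ v) k)
                    (cong (λ i → k ℤ.+ i) (≡-sym (ℤP.neg-involutive (+ deg Γ v))))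

  -- Hence the exact index of {v} satisfies k_{v} ≤ -deg v (as -δ₁ ≤ -deg v).
  kS-singleton-bound : (v : Fin (N Γ)) → kS Γ ⁅ v ⁆ ℤ.≤ ℤ.- (+ deg Γ v)
  kS-singleton-bound v = maximum-filterB-≤ (isAllianceB Γ ⁅ v ⁆)
    (ℤP.neg-mono-≤ (+≤+ (≤-maximum (deg Γ) (∈-allFin v))))
    (singleton-alliance-bound v) (𝒦 Γ)

  contributes : Subset (N Γ) → ℤ → Bool
  contributes S j = nonemptyB Γ S ∧ connectedB Γ S ∧ does ((+ N Γ) ℤ.+ kS Γ S ℤ.≟ j)

  exponent : Fin (N Γ) → ℤ
  exponent v = + N Γ ℤ.+ kS Γ ⁅ v ⁆

  singleton-contributes : (v : Fin (N Γ)) → T (contributes ⁅ v ⁆ (exponent v))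
  singleton-contributes v = Equivalence.from T-∧ (singleton-nonempty v ,
    Equivalence.from T-∧ (singleton-connected v , does-complete (exponent v ℤ.≟ exponent v) refl))

monoCoeff-support : (n : ℕ) (j : ℤ) → 1 ≤ monoCoeff n j → j ≡ + n
monoCoeff-support n j nonzero with j ℤ.≟ + n
... | yes j≡n = j≡n

monoCoeff-at : (n : ℕ) → monoCoeff n (+ n) ≡ n
monoCoeff-at n =
  cong (λ b → if b then n else 0) (Equivalence.to T-≡ (does-complete (+ n ℤ.≟ + n) refl))

-- The arithmetic core: if N + k = n with N ≤ n, then k ≥ 0; so k ≤ -d forces
-- d = 0 and k = 0, whence N = n.
exponent-squeeze : {N n d : ℕ} {k : ℤ} → + N ℤ.+ k ≡ + n → N ≤ n →
  k ℤ.≤ ℤ.- (+ d) → d ≡ 0 × N ≡ n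
exponent-squeeze {N} {n} {zero} {+ m} N+m≡n _ (+≤+ m≤0) = refl , (begin
  N         ≡⟨ ≡-sym (ℕP.+-identityʳ N) ⟩
  N ℕ.+ 0   ≡⟨ cong (N ℕ.+_) (≡-sym (ℕP.n≤0⇒n≡0 m≤0)) ⟩
  N ℕ.+ m   ≡⟨ ℤP.+-injective N+m≡n ⟩
  n         ∎)
  where open ≡-Reasoning
exponent-squeeze {N} {n} {suc d} {+ m} _ _ ()
exponent-squeeze {N} {n} {d} { -[1+ m ]} N-m≡n N≤n _ =
  ⊥-elim (ℕP.<⇒≱ (ℤP.drop‿+<+ (subst (ℤ._< + N) N-m≡n (ℤP.m⊖1+n<m N (suc m)))) N≤n)

edgeless-≅-E : (n : ℕ) (n≥1 : 1 ≤ n) (Γ : Graph) → N Γ ≡ n →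
  (∀ u v → adj Γ u v ≡ false) → Γ ≅ E n n≥1
edgeless-≅-E n n≥1 record { N = .n } refl no-edges =
  record { bij = ↔-id (Fin n) ; preserve = λ u v → ≡-sym (no-edges u v) }

degree-zero-edgeless : (Γ : Graph) → (∀ v → deg Γ v ≡ 0) → ∀ u v → adj Γ u v ≡ false
degree-zero-edgeless Γ deg≡0 u v with adj Γ u v in uv
... | false = refl
... | true  with () ← subst (1 ≤_) (deg≡0 u)
                        (filterB-nonempty (adj Γ u) (∈-allFin v) (Equivalence.from T-≡ uv))

corollary2p10 : (n : ℕ) (n≥1 : 1 ≤ n) (Γ : Graph) →
    (∀ (j : ℤ) → allianceCoeff Γ j ≡ monoCoeff n j) →
    Γ ≅ E n n≥1
corollary2p10 n n≥1 Γ A≡nxⁿ =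
  edgeless-≅-E n n≥1 Γ (proj₂ (squeeze some-vertex)) (degree-zero-edgeless Γ (proj₁ ∘ squeeze))
  where
  open Singletons Γ
  -- Every singleton contributes to A(Γ;x) = n·xⁿ, so its exponent is n ...
  exponent≡n : ∀ v → exponent v ≡ + n
  exponent≡n v = monoCoeff-support n (exponent v) (subst (1 ≤_) (A≡nxⁿ (exponent v))
    (filterB-nonempty _ (subsets-complete (N Γ) ⁅ v ⁆) (singleton-contributes v)))
  -- ... and the N singletons are among the n subsets contributing to xⁿ.
  N≤n : N Γ ≤ n
  N≤n = subst (N Γ ≤_) (trans (A≡nxⁿ (+ n)) (monoCoeff-at n))
    (singletons-counted (N Γ) (λ S → contributes S (+ n))
      (λ v → subst (T ∘ contributes ⁅ v ⁆) (exponent≡n v) (singleton-contributes v)))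
  squeeze : ∀ v → deg Γ v ≡ 0 × N Γ ≡ n
  squeeze v = exponent-squeeze (exponent≡n v) N≤n (kS-singleton-bound v)
  some-vertex : Fin (N Γ)
  some-vertex = fromℕ< (N≥1 Γ)
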